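{- Let $G$ be a $(2n)$-vertex $(r,t)$-RS graph, $X\in\{0,1\}^{r\times t}$, $j\in[t]$, $\mathcal U$ a collection of vertex-disjoint $k$-sequences on $L(M_j)$, and $A=\mathrm{AugGraph}(G,X,j,\mathcal U)$. Then there is a vertex cover $V^*$ of $A$ of size $4n-2r$ that includes all vertices in $\overline{\mathrm{aug}}(A)$ and does not include any vertex of $\mathrm{aug}(A)$.
   Context: A bipartite graph $G=(L,R,E)$ with $|L|=|R|=n$ is called $(2n)$-vertex. A matching is induced if the subgraph induced on its vertices is the matching itself. $G$ is an $(r,t)$-RS graph if its edges are partitioned into $t$ induced matchings $M_1,\dots,M_t$, each of size $r$; fix an ordering $e_{1,j},\dots,e_{r,j}$ of the edges of each $M_j$. $M(u)$ denotes the partner of $u$ in matching $M$. Encoded-RS graph: $H=\mathrm{EncodedRS}(G,X)$ has two vertices $a_v,b_v$ per vertex $v$ of $G$; for $e_{i,j}=(u,v)$ with $u\in L$, it contains $(a_u,a_v),(b_u,b_v)$ if $X_{i,j}=0$ and $(a_u,b_v),(b_u,a_v)$ if $X_{i,j}=1$. The edges coming from $M_j$ form the matching $\mathrm{rep}(M_j)$. For a sequence $\vec u=(u_1,\dots,u_k)$, $k\ge2$, of distinct vertices of $L(M_j)$, with $v_i=M_j(u_i)$, the augmenting edges are $(a_{v_i},a_{u_{i+1}}),(b_{v_i},b_{u_{i+1}})$, $i\in[k-1]$ (these are not edges of $H$), and the augmenting path $AP(\vec u)$ is the unique path starting at $\mathrm{start}(AP(\vec u))=a_{u_1}$ that alternately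 uses an edge of $\mathrm{rep}(M_j)$ and an augmenting edge, ending at $\mathrm{end}(AP(\vec u))\in\{a_{v_k},b_{v_k}\}$. A collection $\mathcal U=(\vec u_1,\dots,\vec u_\ell)$ of $k$-sequences is vertex-disjoint if all vertices used across all sequences are distinct. The augmentation graph $A=\mathrm{AugGraph}(G,X,j,\mathcal U)$ consists of the vertices of $H$ plus new vertex sets $P$ and $Q$, with the edges of $H$ together with: all augmenting edges of all $\vec u_i\in\mathcal U$; a perfect matching between $P$ and the vertices of $H$ not matched by $\mathrm{rep}(M_j)$; and a perfect matching between $Q$ and the vertices $\mathrm{start}(AP(\vec u_i))$, $\vec u_i\in\mathcal U$. With $\vec u_i=(u_{i,1},\dots,u_{i,k})$ and $v_{i,k}=M_j(u_{i,k})$, define $\mathrm{aug}(A)=\{a_{v_{i,k}}: a_{v_{i,k}}=\mathrm{end}(AP(\vec u_i))\}$ and $\overline{\mathrm{aug}}(A)=\{a_{v_{i,k}}: a_{v_{i,k}}\ne\mathrm{end}(AP(\vec u_i))\}$. -}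

module Defs where

open import Data.Nat using (ℕ; zero; suc)
open import Data.Fin using (Fin; toℕ)
open import Data.Bool using (Bool; true; false; if_then_else_)
open import Data.Sum using (_⊎_; inj₁; inj₂)
open import Data.Product using (_×_; _,_; ∃-syntax)
open import Data.List using (List; []; _∷_; map; last; allFin)
open import Data.Maybe using (Maybe; just)
open import Relation.Nullary using (¬_)
open import Relation.Binary.PropositionalEquality using (_≡_; _≢_)

-- A (2n)-vertex (r,t)-RS graph G = (L,R,E), L = R = Fin n (as the two
-- sides of the disjoint union Fin n ⊎ Fin n).  The edge e_{i,j} of the
-- induced matching M_j (i : Fin r, j : Fin t) is (left i j , right i j),
-- with left i j ∈ L and right i j ∈ R.  E is exactly the set of these edges.
record RSGraph (n r t : ℕ) : Set where
  field
    left  : Fin r → Fin t → Fin n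
    right : Fin r → Fin t → Fin n
  IsEdge : Fin n → Fin n → Set
  IsEdge u v = ∃[ i ] ∃[ j ] (left i j ≡ u × right i j ≡ v)
  field
    -- the edges e_{i,j} are pairwise distinct (E is partitioned by the M_j,
    -- and each M_j has exactly r edges)
    distinct : ∀ i j i' j' → left i j ≡ left i' j' → right i j ≡ right i' j'
               → (i ≡ i' × j ≡ j')
    match-left  : ∀ j i i' → left i j ≡ left i' j → i ≡ i'
    match-right : ∀ j i i' → right i j ≡ right i' j → i ≡ i'
    induced : ∀ j i i' → IsEdge (left i j) (right i' j) → i ≡ i'

GV : ℕ → Set
GV n = Fin n ⊎ Fin n   -- inj₁ = L, inj₂ = R

-- the two copies a_v , b_v
data Copy : Set where
  ca cb : Copy

flipC : Copy → Copy
flipC ca = cb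
flipC cb = ca

-- vertices of the encoded graph H: (ca , v) = a_v, (cb , v) = b_v
HV : ℕ → Set
HV n = Copy × GV n

module Aug {n r t : ℕ} (G : RSGraph n r t) (X : Fin r → Fin t → Bool)
           (j : Fin t) {k ℓ : ℕ} (s : Fin ℓ → Fin k → Fin r) where
  open RSGraph G

  -- Sequence number a of 𝒰 is (u_{a,1},...,u_{a,k}) with
  -- u_{a,b} = left (s a b) j ∈ L(M_j) and v_{a,b} = M_j(u_{a,b}) = right (s a b) j.
  u v : Fin ℓ → Fin k → Fin n
  u a b = left (s a b) j
  v a b = right (s a b) j

  IsFirst IsLast : Fin k → Set
  IsFirst b = toℕ b ≡ 0
  IsLast b = suc (toℕ b) ≡ k

  -- edges of H = EncodedRS(G,X)   (first component: the L-side vertex)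
  data HEdge : HV n → HV n → Set where
    e0a : ∀ i j' → X i j' ≡ false → HEdge (ca , inj₁ (left i j')) (ca , inj₂ (right i j'))
    e0b : ∀ i j' → X i j' ≡ false → HEdge (cb , inj₁ (left i j')) (cb , inj₂ (right i j'))
    e1a : ∀ i j' → X i j' ≡ true  → HEdge (ca , inj₁ (left i j')) (cb , inj₂ (right i j'))
    e1b : ∀ i j' → X i j' ≡ true  → HEdge (cb , inj₁ (left i j')) (ca , inj₂ (right i j'))

  -- vertices of H matched by rep(M_j): a_w , b_w for w ∈ V(M_j)
  MatchedRep : HV n → Set
  MatchedRep (_ , w) = ∃[ i ] (w ≡ inj₁ (left i j) ⊎ w ≡ inj₂ (right i j))

  -- The augmenting path AP(u_1..u_k): starting at a_{u_1}, alternately an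
  -- edge of rep(M_j) (from (c,u_i) to (c',v_i), where c' = c if X_{i,j}=0
  -- and c' = flip c if X_{i,j}=1) and an augmenting edge ((c',v_i),(c',u_{i+1})).
  walk : Copy → List (Fin r) → List (HV n)
  walk c [] = []
  walk c (i ∷ is) =
    (c , inj₁ (left i j)) ∷ (c' , inj₂ (right i j)) ∷ walk c' is
    where c' = if X i j then flipC c else c

  AP : Fin ℓ → List (HV n)
  AP a = walk ca (map (s a) (allFin k))

  endAP : Fin ℓ → Maybe (HV n)
  endAP a = last (AP a)

  -- vertices of A = AugGraph(G,X,j,𝒰): vertices of H, the set P (one new
  -- vertex p x per vertex x of H unmatched by rep(M_j)), the set Q (one new
  -- vertex q a per sequence a).
  data AV : Set where
    h : HV n → AV
    p : (x : HV n) → .(¬ MatchedRep x) → AV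
    q : Fin ℓ → AV

  data AEdge : AV → AV → Set where
    hE   : ∀ {x y} → HEdge x y → AEdge (h x) (h y)
    augA : ∀ a b b' → toℕ b' ≡ suc (toℕ b) →
           AEdge (h (ca , inj₂ (v a b))) (h (ca , inj₁ (u a b')))
    augB : ∀ a b b' → toℕ b' ≡ suc (toℕ b) →
           AEdge (h (cb , inj₂ (v a b))) (h (cb , inj₁ (u a b')))
    pE   : ∀ x .(nm : ¬ MatchedRep x) → AEdge (p x nm) (h x)
    -- Q matched to start(AP(u_a)) = a_{u_{a,1}}
    qE   : ∀ a b → IsFirst b → AEdge (q a) (h (ca , inj₁ (u a b)))

  InAug : AV → Set
  InAug x = ∃[ a ] ∃[ b ] (IsLast b × x ≡ h (ca , inj₂ (v a b))
                           × endAP a ≡ just (ca , inj₂ (v a b)))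

  InAugBar : AV → Set
  InAugBar x = ∃[ a ] ∃[ b ] (IsLast b × x ≡ h (ca , inj₂ (v a b))
                              × endAP a ≢ just (ca , inj₂ (v a b)))

-- An augmenting path alternates between edges of rep(M_j) and augmenting edges and enters each
-- edge of rep(M_j) it uses at the L-endpoint. The cover consists of the 4(n - r) vertices of H
-- outside rep(M_j), together with one endpoint of each of the 2r edges of rep(M_j): the endpoint
-- at which a path enters it, or its R-endpoint if no path does. An edge of H outside rep(M_j)
-- comes from an edge of G outside M_j, which has an endpoint outside V(M_j) since M_j is induced;
-- P-edges end outside rep(M_j) and Q-edges at the path starts. An augmenting edge in copy c joins
-- the R-endpoint of one path edge to the L-endpoint of the next; if the path does not enter the
-- next edge in copy c, it does not leave the previous one in copy c either, and as the sequences
-- are vertex-disjoint no other path enters that edge, so its R-endpoint in copy c is chosen. For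
-- the same reason a_{v_k} is chosen exactly when the path does not end there.
module Submission where

open import Defs
open import Data.Nat using (ℕ; zero; suc; _+_; _*_; _∸_; _≤_)
import Data.Nat.Properties as ℕ
open import Data.Nat.Tactic.RingSolver using (solve-∀)
open import Data.Fin using (Fin; toℕ; zero; suc)
import Data.Fin.Properties as Fin
open import Data.Bool using (Bool; true; false; if_then_else_)
open import Data.Empty using (⊥-elim-irr)
open import Data.Sum using (_⊎_; inj₁; inj₂)
import Data.Sum as Sum
open import Data.Sum.Properties using (inj₁-injective; inj₂-injective; ≡-dec)
open import Data.Product using (_×_; _,_; ∃-syntax; proj₁; proj₂)
open import Data.Product.Properties using (,-injective)
open import Data.Maybe using (just)
open import Data.Maybe.Properties using (just-injective)
open import Data.List
  using (List; []; _∷_; map; filter; partition; length; _++_; allFin; tabulate; last; cartesianProduct)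
open import Data.List.Properties
  using (map-tabulate; length-map; length-++; length-tabulate; partition-defn)
open import Data.List.Membership.Propositional using (_∈_; _∉_)
open import Data.List.Membership.Propositional.Properties
  using (∈-map⁺; ∈-map⁻; ∈-filter⁺; ∈-filter⁻; ∈-allFin; ∈-++⁺ˡ; ∈-++⁺ʳ; ∈-++⁻;
         ∈-cartesianProduct⁺; ∈-cartesianProduct⁻)
open import Data.List.Membership.Propositional.Properties.WithK using (unique∧set⇒bag)
import Data.List.Membership.DecPropositional as DecMembership
open import Data.List.Relation.Binary.Subset.Propositional using (_⊆_)
open import Data.List.Relation.Binary.Disjoint.Propositional using (Disjoint)
open import Data.List.Relation.Binary.BagAndSetEquality using (∼bag⇒↭)
open import Data.List.Relation.Binary.Permutation.Propositional.Properties using (↭-length)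
import Data.List.Relation.Binary.Permutation.Setoid.Properties as PermSetoid
open import Data.List.Relation.Unary.Any using (here; there)
open import Data.List.Relation.Unary.All using ([]; _∷_)
open import Data.List.Relation.Unary.AllPairs using ([]; _∷_)
open import Data.List.Relation.Unary.Unique.Propositional using (Unique)
import Data.List.Relation.Unary.Unique.Propositional.Properties as Unique
open import Function.Bundles using (_⇔_; mk⇔)
open import Relation.Binary.Definitions using (DecidableEquality)
open import Relation.Binary.PropositionalEquality
open import Relation.Nullary using (¬_; Dec; yes; no; contradiction)
open import Relation.Nullary.Decidable using (map′; _×-dec_)
open import Relation.Unary using (Pred; Decidable)
open import Relation.Unary.Properties using (∁?)

module _ {A : Set} where

  length-filter-∁ : ∀ {p} {P : Pred A p} (P? : Decidable P) (xs : List A) →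
                    length (filter P? xs) + length (filter (∁? P?) xs) ≡ length xs
  length-filter-∁ P? xs = begin
    length (filter P? xs) + length (filter (∁? P?) xs)
      ≡⟨ length-++ (filter P? xs) ⟨
    length (filter P? xs ++ filter (∁? P?) xs)
      ≡⟨ cong (λ (ys , zs) → length (ys ++ zs)) (partition-defn P? xs) ⟨
    length (proj₁ (partition P? xs) ++ proj₂ (partition P? xs))
      ≡⟨ PermSetoid.xs↭ys⇒|xs|≡|ys| (setoid A) (PermSetoid.partition-↭ (setoid A) P? xs) ⟨
    length xs ∎
    where open ≡-Reasoning

  module _ (_≟_ : DecidableEquality A) where
    open DecMembership _≟_ using (_∈?_)

    length-filter-∉ : ∀ {xs ys} → Unique xs → Unique ys → ys ⊆ xs →
                      length (filter (∁? (_∈? ys)) xs) + length ys ≡ length xs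
    length-filter-∉ {xs} {ys} xs! ys! ys⊆xs = begin
      length (filter (∁? (_∈? ys)) xs) + length ys
        ≡⟨ ℕ.+-comm (length (filter (∁? (_∈? ys)) xs)) (length ys) ⟩
      length ys + length (filter (∁? (_∈? ys)) xs)
        ≡⟨ cong (_+ length (filter (∁? (_∈? ys)) xs)) length-filter-∈ ⟨
      length (filter (_∈? ys) xs) + length (filter (∁? (_∈? ys)) xs)
        ≡⟨ length-filter-∁ (_∈? ys) xs ⟩
      length xs ∎
      where
      open ≡-Reasoning
      filter-∈⇔ : ∀ {x} → (x ∈ filter (_∈? ys) xs) ⇔ (x ∈ ys)
      filter-∈⇔ = mk⇔ (λ x∈ → proj₂ (∈-filter⁻ (_∈? ys) {xs = xs} x∈))
                      (λ x∈ys → ∈-filter⁺ (_∈? ys) (ys⊆xs x∈ys) x∈ys)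
      length-filter-∈ : length (filter (_∈? ys) xs) ≡ length ys
      length-filter-∈ =
        ↭-length (∼bag⇒↭ (unique∧set⇒bag (Unique.filter⁺ (_∈? ys) xs!) ys! filter-∈⇔))

double-complement : ∀ u n r → u + (r + r) ≡ n + n → 2 * u + 2 * r ≡ 4 * n ∸ 2 * r
double-complement u n r eq = sym (begin
  4 * n ∸ 2 * r                    ≡⟨ cong (_∸ 2 * r) (quadruple n) ⟩
  2 * (n + n) ∸ 2 * r              ≡⟨ cong (λ m → 2 * m ∸ 2 * r) eq ⟨
  2 * (u + (r + r)) ∸ 2 * r        ≡⟨ cong (_∸ 2 * r) (regroup u r) ⟩
  (2 * u + 2 * r) + 2 * r ∸ 2 * r  ≡⟨ ℕ.m+n∸n≡m (2 * u + 2 * r) (2 * r) ⟩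
  2 * u + 2 * r                    ∎)
  where
  open ≡-Reasoning
  quadruple : ∀ m → 4 * m ≡ 2 * (m + m)
  quadruple = solve-∀
  regroup : ∀ u r → 2 * (u + (r + r)) ≡ (2 * u + 2 * r) + 2 * r
  regroup = solve-∀

length-allFin : ∀ n → length (allFin n) ≡ n
length-allFin n = length-tabulate (λ i → i)

module _ {A B : Set} where

  length-cartesianProduct : (xs : List A) (ys : List B) →
                            length (cartesianProduct xs ys) ≡ length xs * length ys
  length-cartesianProduct []       ys = refl
  length-cartesianProduct (x ∷ xs) ys = begin
    length (map (x ,_) ys ++ cartesianProduct xs ys)
      ≡⟨ length-++ (map (x ,_) ys) ⟩
    length (map (x ,_) ys) + length (cartesianProduct xs ys)
      ≡⟨ cong₂ _+_ (length-map (x ,_) ys) (length-cartesianProduct xs ys) ⟩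
    length ys + length xs * length ys ∎
    where open ≡-Reasoning

  disjointUnion : List A → List B → List (A ⊎ B)
  disjointUnion xs ys = map inj₁ xs ++ map inj₂ ys

  length-disjointUnion : (xs : List A) (ys : List B) →
                         length (disjointUnion xs ys) ≡ length xs + length ys
  length-disjointUnion xs ys =
    trans (length-++ (map inj₁ xs)) (cong₂ _+_ (length-map inj₁ xs) (length-map inj₂ ys))

  ∈-disjointUnion⁺ˡ : ∀ {x xs} {ys : List B} → x ∈ xs → inj₁ x ∈ disjointUnion xs ys
  ∈-disjointUnion⁺ˡ x∈xs = ∈-++⁺ˡ (∈-map⁺ inj₁ x∈xs)

  ∈-disjointUnion⁺ʳ : ∀ {y} {xs : List A} {ys} → y ∈ ys → inj₂ y ∈ disjointUnion xs ys
  ∈-disjointUnion⁺ʳ {xs = xs} y∈ys = ∈-++⁺ʳ (map inj₁ xs) (∈-map⁺ inj₂ y∈ys)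

  ∈-disjointUnion⁻ˡ : ∀ xs ys {x} → inj₁ x ∈ disjointUnion xs ys → x ∈ xs
  ∈-disjointUnion⁻ˡ xs ys x∈ with ∈-++⁻ (map inj₁ xs) x∈
  ... | inj₁ x∈₁ with _ , x∈xs , refl ← ∈-map⁻ inj₁ x∈₁ = x∈xs
  ... | inj₂ x∈₂ with () ← proj₂ (proj₂ (∈-map⁻ inj₂ x∈₂))

  ∈-disjointUnion⁻ʳ : ∀ xs ys {y} → inj₂ y ∈ disjointUnion xs ys → y ∈ ys
  ∈-disjointUnion⁻ʳ xs ys y∈ with ∈-++⁻ (map inj₁ xs) y∈
  ... | inj₁ y∈₁ with () ← proj₂ (proj₂ (∈-map⁻ inj₁ y∈₁))
  ... | inj₂ y∈₂ with _ , y∈ys , refl ← ∈-map⁻ inj₂ y∈₂ = y∈ys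

  disjointUnion⁺ : ∀ {xs ys} → Unique xs → Unique ys → Unique (disjointUnion xs ys)
  disjointUnion⁺ xs! ys! =
    Unique.++⁺ (Unique.map⁺ inj₁-injective xs!) (Unique.map⁺ inj₂-injective ys!) tags-differ
    where
    tags-differ : Disjoint (map inj₁ _) (map inj₂ _)
    tags-differ (z∈₁ , z∈₂) with _ , _ , refl ← ∈-map⁻ inj₁ z∈₁
      with () ← proj₂ (proj₂ (∈-map⁻ inj₂ z∈₂))

allCopies : List Copy
allCopies = ca ∷ cb ∷ []

∈-allCopies : ∀ c → c ∈ allCopies
∈-allCopies ca = here refl
∈-allCopies cb = there (here refl)

allCopies! : Unique allCopies
allCopies! = ((λ ()) ∷ []) ∷ [] ∷ []

flipC-involutive : ∀ c → flipC (flipC c) ≡ c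
flipC-involutive ca = refl
flipC-involutive cb = refl

_≟ᶜ_ : DecidableEquality Copy
ca ≟ᶜ ca = yes refl
ca ≟ᶜ cb = no λ ()
cb ≟ᶜ ca = no λ ()
cb ≟ᶜ cb = yes refl

module AugmentingPaths {n r t : ℕ} (G : RSGraph n r t) (X : Fin r → Fin t → Bool) (j : Fin t)
         {k ℓ : ℕ} (s : Fin ℓ → Fin k → Fin r) where
  open RSGraph G
  open Aug G X j s

  -- The copy of the R-endpoint of the edge of rep(M_j) from e_{i,j} whose L-endpoint is in copy c.
  step : Fin r → Copy → Copy
  step i c = if X i j then flipC c else c

  step-involutive : ∀ i c → step i (step i c) ≡ c
  step-involutive i c with X i j
  ... | true  = flipC-involutive c
  ... | false = refl

  step-injective : ∀ i {c c'} → step i c ≡ step i c' → c ≡ c'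
  step-injective i {c} {c'} eq = begin
    c                   ≡⟨ step-involutive i c ⟨
    step i (step i c)   ≡⟨ cong (step i) eq ⟩
    step i (step i c')  ≡⟨ step-involutive i c' ⟩
    c'                  ∎
    where open ≡-Reasoning

  step-false : ∀ {i c} → X i j ≡ false → step i c ≡ c
  step-false {c = c} X≡0 = cong (λ x → if x then flipC c else c) X≡0

  step-true : ∀ {i c} → X i j ≡ true → step i c ≡ flipC c
  step-true {c = c} X≡1 = cong (λ x → if x then flipC c else c) X≡1

  -- The copy in which walk c (tabulate f) visits the L-endpoint of its b-th edge.
  copyAt : ∀ {m} → (Fin m → Fin r) → Copy → Fin m → Copy
  copyAt f c zero    = c
  copyAt f c (suc b) = copyAt (λ b → f (suc b)) (step (f zero) c) b

  copyAt-first : ∀ {m} (f : Fin m → Fin r) c b → toℕ b ≡ 0 → copyAt f c b ≡ c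
  copyAt-first f c zero _ = refl

  copyAt-next : ∀ {m} (f : Fin m → Fin r) c b b' → toℕ b' ≡ suc (toℕ b) →
                copyAt f c b' ≡ step (f b) (copyAt f c b)
  copyAt-next f c zero    (suc zero) _ = refl
  copyAt-next f c (suc b) (suc b')   eq =
    copyAt-next (λ b → f (suc b)) (step (f zero) c) b b' (ℕ.suc-injective eq)

  last-walk : ∀ {m} (f : Fin m → Fin r) c b → suc (toℕ b) ≡ m →
              last (walk c (tabulate f)) ≡ just (step (f b) (copyAt f c b) , inj₂ (right (f b) j))
  last-walk {suc zero}    f c zero    _  = refl
  last-walk {suc (suc m)} f c (suc b) eq =
    last-walk (λ b → f (suc b)) (step (f zero) c) b (ℕ.suc-injective eq)

  entryCopy : Fin ℓ → Fin k → Copy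
  entryCopy a = copyAt (s a) ca

  endAP-last : ∀ a b → IsLast b → endAP a ≡ just (step (s a b) (entryCopy a b) , inj₂ (v a b))
  endAP-last a b isLast = begin
    last (walk ca (map (s a) (tabulate (λ b → b))))
      ≡⟨ cong (λ xs → last (walk ca xs)) (map-tabulate (λ b → b) (s a)) ⟩
    last (walk ca (tabulate (s a)))                 ≡⟨ last-walk (s a) ca b isLast ⟩
    just (step (s a b) (entryCopy a b) , inj₂ (v a b))  ∎
    where open ≡-Reasoning

  allGV : List (GV n)
  allGV = disjointUnion (allFin n) (allFin n)

  ∈-allGV : ∀ w → w ∈ allGV
  ∈-allGV (inj₁ w) = ∈-disjointUnion⁺ˡ (∈-allFin w)
  ∈-allGV (inj₂ w) = ∈-disjointUnion⁺ʳ (∈-allFin w)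

  allGV! : Unique allGV
  allGV! = disjointUnion⁺ (Unique.allFin⁺ n) (Unique.allFin⁺ n)

  lefts rights : List (Fin n)
  lefts  = map (λ i → left i j) (allFin r)
  rights = map (λ i → right i j) (allFin r)

  matchedGV : List (GV n)
  matchedGV = disjointUnion lefts rights

  matchedGV! : Unique matchedGV
  matchedGV! = disjointUnion⁺ (Unique.map⁺ (match-left j _ _) (Unique.allFin⁺ r))
                              (Unique.map⁺ (match-right j _ _) (Unique.allFin⁺ r))

  ∈-matchedGV⁺ : ∀ {c w} → MatchedRep (c , w) → w ∈ matchedGV
  ∈-matchedGV⁺ (i , inj₁ refl) = ∈-disjointUnion⁺ˡ (∈-map⁺ _ (∈-allFin i))
  ∈-matchedGV⁺ (i , inj₂ refl) = ∈-disjointUnion⁺ʳ (∈-map⁺ _ (∈-allFin i))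

  ∈-matchedGV⁻ : ∀ {c w} → w ∈ matchedGV → MatchedRep (c , w)
  ∈-matchedGV⁻ {w = inj₁ w} w∈
    with i , _ , refl ← ∈-map⁻ (λ i → left i j) (∈-disjointUnion⁻ˡ lefts rights w∈) = i , inj₁ refl
  ∈-matchedGV⁻ {w = inj₂ w} w∈
    with i , _ , refl ← ∈-map⁻ (λ i → right i j) (∈-disjointUnion⁻ʳ lefts rights w∈) = i , inj₂ refl

  _≟GV_ : DecidableEquality (GV n)
  _≟GV_ = ≡-dec Fin._≟_ Fin._≟_

  open DecMembership _≟GV_ using (_∈?_)

  matchedRep? : ∀ x → Dec (MatchedRep x)
  matchedRep? (c , w) = map′ (∈-matchedGV⁻ {c}) (∈-matchedGV⁺ {c}) (w ∈? matchedGV)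

  unmatchedGV : List (GV n)
  unmatchedGV = filter (∁? (_∈? matchedGV)) allGV

  ∈-unmatchedGV⁺ : ∀ {c w} → ¬ MatchedRep (c , w) → w ∈ unmatchedGV
  ∈-unmatchedGV⁺ {c} ¬m =
    ∈-filter⁺ (∁? (_∈? matchedGV)) (∈-allGV _) (λ w∈ → ¬m (∈-matchedGV⁻ {c} w∈))

  ∈-unmatchedGV⁻ : ∀ {c w} → w ∈ unmatchedGV → ¬ MatchedRep (c , w)
  ∈-unmatchedGV⁻ {c} w∈ m =
    proj₂ (∈-filter⁻ (∁? (_∈? matchedGV)) {xs = allGV} w∈) (∈-matchedGV⁺ {c} m)

  length-unmatchedGV : length unmatchedGV + (r + r) ≡ n + n
  length-unmatchedGV = begin
    length unmatchedGV + (r + r)          ≡⟨ cong (length unmatchedGV +_) length-matchedGV ⟨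
    length unmatchedGV + length matchedGV ≡⟨ length-filter-∉ _≟GV_ allGV! matchedGV! (λ _ → ∈-allGV _) ⟩
    length allGV                          ≡⟨ length-disjointUnion (allFin n) (allFin n) ⟩
    length (allFin n) + length (allFin n) ≡⟨ cong₂ _+_ (length-allFin n) (length-allFin n) ⟩
    n + n                                 ∎
    where
    open ≡-Reasoning
    length-matchedGV : length matchedGV ≡ r + r
    length-matchedGV = trans (length-disjointUnion lefts rights)
      (cong₂ _+_ (trans (length-map _ (allFin r)) (length-allFin r))
                 (trans (length-map _ (allFin r)) (length-allFin r)))

  matchedEnds⇒sameMatching : ∀ {i j' c c'} → MatchedRep (c , inj₁ (left i j')) →
                             MatchedRep (c' , inj₂ (right i j')) → j' ≡ j
  matchedEnds⇒sameMatching {i} {j'} (i₁ , inj₁ eq₁) (i₂ , inj₂ eq₂)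
    with refl ← induced j i₁ i₂ (i , j' , inj₁-injective eq₁ , inj₂-injective eq₂)
    = proj₂ (distinct i j' i₁ j (inj₁-injective eq₁) (inj₂-injective eq₂))

  h-injective : ∀ {x y} → h x ≡ h y → x ≡ y
  h-injective refl = refl

  module VertexCover (s-injective : ∀ a b a' b' → s a b ≡ s a' b' → (a ≡ a' × b ≡ b')) where

    Entered : Fin r → Copy → Set
    Entered i c = ∃[ a ] ∃[ b ] (s a b ≡ i × entryCopy a b ≡ c)

    entered? : ∀ i c → Dec (Entered i c)
    entered? i c = Fin.any? λ a → Fin.any? λ b → (s a b Fin.≟ i) ×-dec (entryCopy a b ≟ᶜ c)

    Entered⇒entryCopy : ∀ {a b c} → Entered (s a b) c → entryCopy a b ≡ c
    Entered⇒entryCopy {a} {b} (a' , b' , eq , entered)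
      with refl , refl ← s-injective a' b' a b eq = entered

    coverEnd : Copy × Fin r → HV n
    coverEnd (c , i) = endpoint (entered? i c)
      where
      endpoint : Dec (Entered i c) → HV n
      endpoint (yes _) = c , inj₁ (left i j)
      endpoint (no  _) = step i c , inj₂ (right i j)

    coverEnd-view : ∀ c i → (Entered i c × coverEnd (c , i) ≡ (c , inj₁ (left i j)))
                          ⊎ (¬ Entered i c × coverEnd (c , i) ≡ (step i c , inj₂ (right i j)))
    coverEnd-view c i with entered? i c
    ... | yes entered  = inj₁ (entered , refl)
    ... | no ¬entered  = inj₂ (¬entered , refl)

    coverEnd-entered : ∀ {i c} → Entered i c → coverEnd (c , i) ≡ (c , inj₁ (left i j))
    coverEnd-entered {i} {c} entered with entered? i c
    ... | yes _        = refl
    ... | no ¬entered  = contradiction entered ¬entered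

    coverEnd-exit : ∀ {i c} → ¬ Entered i c → coverEnd (c , i) ≡ (step i c , inj₂ (right i j))
    coverEnd-exit {i} {c} ¬entered with entered? i c
    ... | yes entered = contradiction entered ¬entered
    ... | no _        = refl

    coverEnd-matched : ∀ ci → MatchedRep (coverEnd ci)
    coverEnd-matched (c , i) with entered? i c
    ... | yes _ = i , inj₁ refl
    ... | no  _ = i , inj₂ refl

    coverEnd-injective : ∀ {ci ci'} → coverEnd ci ≡ coverEnd ci' → ci ≡ ci'
    coverEnd-injective {c , i} {c' , i'} eq with coverEnd-view c i | coverEnd-view c' i'
    ... | inj₁ (_ , eq₁) | inj₁ (_ , eq₂)
      with refl , eq' ← ,-injective (trans (sym eq₁) (trans eq eq₂))
      = cong (c ,_) (match-left j i i' (inj₁-injective eq'))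
    ... | inj₂ (_ , eq₁) | inj₂ (_ , eq₂)
      with eqᶜ , eq' ← ,-injective (trans (sym eq₁) (trans eq eq₂))
      with refl ← match-right j i i' (inj₂-injective eq') = cong (_, i) (step-injective i eqᶜ)
    ... | inj₁ (_ , eq₁) | inj₂ (_ , eq₂) with () ← trans (sym eq₁) (trans eq eq₂)
    ... | inj₂ (_ , eq₁) | inj₁ (_ , eq₂) with () ← trans (sym eq₁) (trans eq eq₂)

    coverEnd-right : ∀ {c i c' w} → coverEnd (c , i) ≡ (c' , inj₂ w) →
                     ¬ Entered i c × step i c ≡ c' × right i j ≡ w
    coverEnd-right {c} {i} eq with coverEnd-view c i
    ... | inj₁ (_ , eq₁) with () ← trans (sym eq₁) eq
    ... | inj₂ (¬entered , eq₁) with eqᶜ , eq' ← ,-injective (trans (sym eq₁) eq) =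
      ¬entered , eqᶜ , inj₂-injective eq'

    repEdges : List (Copy × Fin r)
    repEdges = cartesianProduct allCopies (allFin r)

    cover : List (HV n)
    cover = cartesianProduct allCopies unmatchedGV ++ map coverEnd repEdges

    ∈-cover-unmatched : ∀ {x} → ¬ MatchedRep x → x ∈ cover
    ∈-cover-unmatched {c , w} ¬m =
      ∈-++⁺ˡ (∈-cartesianProduct⁺ (∈-allCopies c) (∈-unmatchedGV⁺ {c} ¬m))

    ∈-cover-end : ∀ ci → coverEnd ci ∈ cover
    ∈-cover-end (c , i) = ∈-++⁺ʳ (cartesianProduct allCopies unmatchedGV)
      (∈-map⁺ coverEnd (∈-cartesianProduct⁺ (∈-allCopies c) (∈-allFin i)))

    ∈-cover⁻ : ∀ {x} → x ∈ cover → ¬ MatchedRep x ⊎ ∃[ ci ] x ≡ coverEnd ci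
    ∈-cover⁻ {c , w} x∈ with ∈-++⁻ (cartesianProduct allCopies unmatchedGV) x∈
    ... | inj₁ x∈₁ =
      inj₁ (∈-unmatchedGV⁻ {c} (proj₂ (∈-cartesianProduct⁻ allCopies unmatchedGV x∈₁)))
    ... | inj₂ x∈₂ with ci , _ , eq ← ∈-map⁻ coverEnd x∈₂ = inj₂ (ci , eq)

    cover! : Unique cover
    cover! = Unique.++⁺
      (Unique.cartesianProduct⁺ allCopies! (Unique.filter⁺ (∁? (_∈? matchedGV)) allGV!))
      (Unique.map⁺ coverEnd-injective (Unique.cartesianProduct⁺ allCopies! (Unique.allFin⁺ r)))
      unmatched-disjoint-ends
      where
      unmatched-disjoint-ends : Disjoint (cartesianProduct allCopies unmatchedGV) (map coverEnd repEdges)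
      unmatched-disjoint-ends (x∈₁ , x∈₂) with ci , _ , refl ← ∈-map⁻ coverEnd x∈₂ =
        ∈-unmatchedGV⁻ {proj₁ (coverEnd ci)} (proj₂ (∈-cartesianProduct⁻ allCopies unmatchedGV x∈₁))
          (coverEnd-matched ci)

    length-cover : length cover ≡ 4 * n ∸ 2 * r
    length-cover = begin
      length cover
        ≡⟨ length-++ (cartesianProduct allCopies unmatchedGV) ⟩
      length (cartesianProduct allCopies unmatchedGV) + length (map coverEnd repEdges)
        ≡⟨ cong₂ _+_ (length-cartesianProduct allCopies unmatchedGV)
                     (trans (length-map coverEnd repEdges)
                            (trans (length-cartesianProduct allCopies (allFin r))
                                   (cong (2 *_) (length-allFin r)))) ⟩
      2 * length unmatchedGV + 2 * r
        ≡⟨ double-complement (length unmatchedGV) n r length-unmatchedGV ⟩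
      4 * n ∸ 2 * r ∎
      where
      open ≡-Reasoning

    entry-covered : ∀ {i c} → Entered i c → (c , inj₁ (left i j)) ∈ cover
    entry-covered {i} {c} entered =
      subst (_∈ cover) (coverEnd-entered entered) (∈-cover-end (c , i))

    exit-covered : ∀ {i c} → ¬ Entered i (step i c) → (c , inj₂ (right i j)) ∈ cover
    exit-covered {i} {c} ¬entered = subst (_∈ cover)
      (trans (coverEnd-exit ¬entered) (cong (λ c' → c' , inj₂ (right i j)) (step-involutive i c)))
      (∈-cover-end (step i c , i))

    repEdge-covered : ∀ i c →
                      (c , inj₁ (left i j)) ∈ cover ⊎ (step i c , inj₂ (right i j)) ∈ cover
    repEdge-covered i c with entered? i c
    ... | yes entered = inj₁ (entry-covered entered)
    ... | no ¬entered = inj₂ (subst (_∈ cover) (coverEnd-exit ¬entered) (∈-cover-end (c , i)))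

    GEdge-covered : ∀ i j' c c' → (j' ≡ j → c' ≡ step i c) →
                    (c , inj₁ (left i j')) ∈ cover ⊎ (c' , inj₂ (right i j')) ∈ cover
    GEdge-covered i j' c c' inMj⇒step with j' Fin.≟ j
    ... | yes refl rewrite inMj⇒step refl = repEdge-covered i c
    ... | no j'≢j with matchedRep? (c , inj₁ (left i j')) | matchedRep? (c' , inj₂ (right i j'))
    ...   | no ¬m | _     = inj₁ (∈-cover-unmatched ¬m)
    ...   | yes _ | no ¬m = inj₂ (∈-cover-unmatched ¬m)
    ...   | yes m | yes m' = contradiction (matchedEnds⇒sameMatching {i} {j'} {c} {c'} m m') j'≢j

    HEdge-covered : ∀ {x y} → HEdge x y → x ∈ cover ⊎ y ∈ cover
    HEdge-covered (e0a i j' X≡0) = GEdge-covered i j' ca ca λ { refl → sym (step-false X≡0) }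
    HEdge-covered (e0b i j' X≡0) = GEdge-covered i j' cb cb λ { refl → sym (step-false X≡0) }
    HEdge-covered (e1a i j' X≡1) = GEdge-covered i j' ca cb λ { refl → sym (step-true X≡1) }
    HEdge-covered (e1b i j' X≡1) = GEdge-covered i j' cb ca λ { refl → sym (step-true X≡1) }

    augEdge-covered : ∀ a b b' → toℕ b' ≡ suc (toℕ b) → ∀ c →
                      (c , inj₂ (v a b)) ∈ cover ⊎ (c , inj₁ (u a b')) ∈ cover
    augEdge-covered a b b' next c with entered? (s a b') c
    ... | yes entered = inj₂ (entry-covered entered)
    ... | no ¬entered =
      inj₁ (exit-covered λ entered → ¬entered (a , b' , refl , entryCopy≡c entered))
      where
      open ≡-Reasoning
      entryCopy≡c : Entered (s a b) (step (s a b) c) → entryCopy a b' ≡ c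
      entryCopy≡c entered = begin
        entryCopy a b'                 ≡⟨ copyAt-next (s a) ca b b' next ⟩
        step (s a b) (entryCopy a b)   ≡⟨ cong (step (s a b)) (Entered⇒entryCopy entered) ⟩
        step (s a b) (step (s a b) c)  ≡⟨ step-involutive (s a b) c ⟩
        c                              ∎

    V* : List AV
    V* = map h cover

    V*! : Unique V*
    V*! = Unique.map⁺ h-injective cover!

    length-V* : length V* ≡ 4 * n ∸ 2 * r
    length-V* = trans (length-map h cover) length-cover

    ∈-V*⁺ : ∀ {x y} → x ∈ cover ⊎ y ∈ cover → h x ∈ V* ⊎ h y ∈ V*
    ∈-V*⁺ = Sum.map (∈-map⁺ h) (∈-map⁺ h)

    AEdge-covered : ∀ x y → AEdge x y → x ∈ V* ⊎ y ∈ V*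
    AEdge-covered _ _ (hE e)             = ∈-V*⁺ (HEdge-covered e)
    AEdge-covered _ _ (augA a b b' next) = ∈-V*⁺ (augEdge-covered a b b' next ca)
    AEdge-covered _ _ (augB a b b' next) = ∈-V*⁺ (augEdge-covered a b b' next cb)
    AEdge-covered _ _ (pE x ¬m)          = inj₂ (∈-map⁺ h (∈-cover-unmatched λ m → ⊥-elim-irr (¬m m)))
    AEdge-covered _ _ (qE a b first)     =
      inj₂ (∈-map⁺ h (entry-covered (a , b , refl , copyAt-first (s a) ca b first)))

    augBar-covered : ∀ x → InAugBar x → x ∈ V*
    augBar-covered _ (a , b , isLast , refl , end≢) =
      ∈-map⁺ h (exit-covered λ entered → end≢ (ends-in-a entered))
      where
      open ≡-Reasoning
      i = s a b
      ends-in-a : Entered i (step i ca) → endAP a ≡ just (ca , inj₂ (v a b))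
      ends-in-a entered = begin
        endAP a
          ≡⟨ endAP-last a b isLast ⟩
        just (step i (entryCopy a b) , inj₂ (v a b))
          ≡⟨ cong (λ c → just (step i c , inj₂ (v a b))) (Entered⇒entryCopy entered) ⟩
        just (step i (step i ca) , inj₂ (v a b))
          ≡⟨ cong (λ c → just (c , inj₂ (v a b))) (step-involutive i ca) ⟩
        just (ca , inj₂ (v a b)) ∎

    aug-uncovered : ∀ x → InAug x → x ∉ V*
    aug-uncovered _ (a , b , isLast , refl , end≡) x∈
      with _ , x∈cover , refl ← ∈-map⁻ h x∈ with ∈-cover⁻ x∈cover
    ... | inj₁ ¬m = ¬m (s a b , inj₂ refl)
    ... | inj₂ ((c , i) , eq) with ¬entered , step≡ca , right≡v ← coverEnd-right (sym eq)
      with refl ← match-right j i (s a b) right≡v =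
      ¬entered (a , b , refl , step-injective i (trans exit-copy (sym step≡ca)))
      where
      exit-copy : step i (entryCopy a b) ≡ ca
      exit-copy = cong proj₁ (just-injective (trans (sym (endAP-last a b isLast)) end≡))

lemma3p8 : (n r t : ℕ) (G : RSGraph n r t) (X : Fin r → Fin t → Bool) (j : Fin t)
    (k ℓ : ℕ) → 2 ≤ k → (s : Fin ℓ → Fin k → Fin r)
    → (∀ a b a' b' → s a b ≡ s a' b' → (a ≡ a' × b ≡ b'))
    → ∃[ V* ] (Unique V* × length V* ≡ 4 * n ∸ 2 * r
       × (∀ x y → Aug.AEdge G X j s x y → x ∈ V* ⊎ y ∈ V*)
       × (∀ x → Aug.InAugBar G X j s x → x ∈ V*)
       × (∀ x → Aug.InAug G X j s x → x ∉ V*))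
lemma3p8 n r t G X j k ℓ _ s s-injective =
  V* , V*! , length-V* , AEdge-covered , augBar-covered , aug-uncovered
  where
  open AugmentingPaths G X j s
  open VertexCover s-injective
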